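{- For every $n \geq 3$, the cycle $C_n$ on $n$ vertices satisfies $\gamma_{gr}^L(C_n) = n - 1$.
   Context: For a vertex $v$, $N(v)$ is its open neighborhood (the set of its neighbors) and $N[v] = N(v) \cup \{v\}$ its closed neighborhood. An L-sequence of a graph $G$ is a sequence $(v_1, \ldots, v_k)$ of distinct vertices of $G$ such that for every $i \in \{1,\ldots,k\}$, $N[v_i] \setminus \bigcup_{j=1}^{i-1} N(v_j) \neq \emptyset$. The L-Grundy domination number $\gamma_{gr}^L(G)$ is the maximum length of an L-sequence of $G$. -}

module Defs where

open import Data.Nat using (ℕ; suc; _+_; _%_; _≤_; NonZero)
open import Data.Fin using (Fin; toℕ)
open import Data.List using (List; []; _∷_; length)
open import Data.List.Relation.Unary.All using (All)
open import Data.List.Relation.Unary.Unique.Propositional using (Unique)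
open import Data.Product using (Σ; ∃; _×_)
open import Data.Sum using (_⊎_)
open import Relation.Binary.PropositionalEquality using (_≡_)
open import Relation.Nullary using (¬_)
open import Data.Unit using (⊤)

-- A graph given by its vertex type and adjacency relation.
-- (Simplicity is not recorded as a field; the only graph used, the cycle C_n
-- with n ≥ 3, has a symmetric irreflexive adjacency by construction.)
record Graph : Set₁ where
  field
    V     : Set
    Adj   : V → V → Set

module _ (G : Graph) where
  open Graph G

  InOpenNbhd : V → V → Set
  InOpenNbhd u v = Adj v u

  InClosedNbhd : V → V → Set
  InClosedNbhd u v = (u ≡ v) ⊎ Adj v u

  LStep : List V → V → Set
  LStep prev v = ∃ λ u → InClosedNbhd u v × All (λ w → ¬ InOpenNbhd u w) prev

  -- Condition on a sequence, checked with the accumulated prefix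
  -- (the prefix is stored in reverse order, which is irrelevant for the union).
  LCond : List V → List V → Set
  LCond prev []       = ⊤
  LCond prev (v ∷ vs) = LStep prev v × LCond (v ∷ prev) vs

  IsLSequence : List V → Set
  IsLSequence vs = Unique vs × LCond [] vs

  IsLGrundyNumber : ℕ → Set
  IsLGrundyNumber k =
    (∃ λ vs → IsLSequence vs × length vs ≡ k) ×
    (∀ vs → IsLSequence vs → length vs ≤ k)

CycleAdj : (n : ℕ) → .{{_ : NonZero n}} → Fin n → Fin n → Set
CycleAdj n i j = (toℕ j ≡ (suc (toℕ i)) % n) ⊎ (toℕ i ≡ (suc (toℕ j)) % n)

Cycle : (n : ℕ) → .{{_ : NonZero n}} → Graph
Cycle n = record { V = Fin n ; Adj = CycleAdj n }

{-# OPTIONS --safe #-}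
module Submission where

-- Lower bound: listing the vertices 0, …, n − 4 and then n − 2, n − 1, each vertex i < n − 3
-- is footprinted by i + 1, and n − 2, n − 1 are both footprinted by n − 2.
-- Upper bound: every vertex of C_n has two distinct neighbours, so the footprint of the last
-- vertex of an L-sequence is a neighbour of some vertex other than it; that vertex cannot have
-- been listed earlier, hence an L-sequence misses at least one of the n vertices.

open import Defs
open import Data.Nat using (ℕ; zero; suc; pred; _+_; _*_; _∸_; _≤_; _<_; _%_; _/_; s≤s; z≤n; NonZero)
open import Data.Nat.Properties
open import Data.Nat.DivMod
  using (_mod_; m%n<n; m%n≤m; m<n⇒m%n≡m; m%n%n≡m%n; %-distribˡ-+; [m+n]%n≡m%n; m≡m%n+[m/n]*n)
open import Data.Fin using (Fin; zero; suc; toℕ)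
open import Data.Fin.Properties using (toℕ-fromℕ<; toℕ<n; all?; ¬∀⟶∃¬; injective⇒≤)
open import Data.List using (List; []; _∷_; length; lookup)
open import Data.List.Membership.Propositional using (_∈_)
open import Data.List.Membership.Propositional.Properties using (∈-lookup)
open import Data.List.Relation.Unary.All as All using (All; []; _∷_)
open import Data.List.Relation.Unary.All.Properties using (¬Any⇒All¬)
open import Data.List.Relation.Unary.AllPairs using ([]; _∷_)
open import Data.List.Relation.Unary.Any using (here; there)
open import Data.List.Relation.Unary.Unique.Propositional using (Unique)
open import Data.Product using (∃₂; _×_; _,_)
open import Data.Sum using (_⊎_; inj₁; inj₂; swap; reduce)
open import Data.Unit using (tt)
open import Function.Definitions using (Injective)
open import Relation.Binary.PropositionalEquality
open import Relation.Nullary using (¬_; yes; no; contradiction)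

lookup-injective : ∀ {a} {A : Set a} {xs : List A} → Unique xs → Injective _≡_ _≡_ (lookup xs)
lookup-injective {xs = _ ∷ _} (_    ∷ _)    {zero}  {zero}  _  = refl
lookup-injective {xs = _ ∷ _} (x∉xs ∷ _)    {zero}  {suc j} eq =
  contradiction eq (All.lookup x∉xs (∈-lookup j))
lookup-injective {xs = _ ∷ _} (x∉xs ∷ _)    {suc i} {zero}  eq =
  contradiction (sym eq) (All.lookup x∉xs (∈-lookup i))
lookup-injective {xs = _ ∷ _} (_    ∷ uniq) {suc i} {suc j} eq = cong suc (lookup-injective uniq eq)

unique⇒length≤ : ∀ {n} {xs : List (Fin n)} → Unique xs → length xs ≤ n
unique⇒length≤ uniq = injective⇒≤ (lookup-injective uniq)

module _ (G : Graph) where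

  MinDegree≥2 : Set
  MinDegree≥2 = ∀ u → ∃₂ λ a b → a ≢ b × InOpenNbhd G u a × InOpenNbhd G u b

  LCond-∷⇒¬covering : MinDegree≥2 → ∀ {prev v vs} → LCond G prev (v ∷ vs) →
                      ¬ (∀ x → x ∈ prev ⊎ x ∈ v ∷ vs)
  LCond-∷⇒¬covering minDeg {vs = []} ((u , _ , fresh) , _) covers
    with a , b , a≢b , u∈N[a] , u∈N[b] ← minDeg u
    with covers a | covers b
  ... | inj₁ a∈prev       | _                 = All.lookup fresh a∈prev u∈N[a]
  ... | _                 | inj₁ b∈prev       = All.lookup fresh b∈prev u∈N[b]
  ... | inj₂ (here a≡v)   | inj₂ (here b≡v)   = a≢b (trans a≡v (sym b≡v))
  ... | inj₂ (there ())   | _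
  ... | _                 | inj₂ (there ())
  LCond-∷⇒¬covering minDeg {prev} {v} {v′ ∷ vs} (_ , lcond) covers =
    LCond-∷⇒¬covering minDeg lcond covers′
    where
    covers′ : ∀ x → x ∈ v ∷ prev ⊎ x ∈ v′ ∷ vs
    covers′ x with covers x
    ... | inj₁ x∈prev       = inj₁ (there x∈prev)
    ... | inj₂ (here x≡v)   = inj₁ (here x≡v)
    ... | inj₂ (there x∈vs) = inj₂ x∈vs

FinGraph : (n : ℕ) → (Fin n → Fin n → Set) → Graph
FinGraph n adj = record { V = Fin n ; Adj = adj }

module _ {n : ℕ} {adj : Fin n → Fin n → Set} where
  open import Data.List.Membership.DecPropositional (Data.Fin._≟_ {n}) using (_∈?_)

  LSequence-length≤ : MinDegree≥2 (FinGraph n adj) → ∀ {vs} → IsLSequence (FinGraph n adj) vs →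
                      length vs ≤ pred n
  LSequence-length≤ minDeg {vs} (uniq , _) with all? (_∈? vs)
  ... | no ¬covering =
    let x , x∉vs = ¬∀⟶∃¬ n (_∈ vs) (_∈? vs) ¬covering
    in suc[m]≤n⇒m≤pred[n] (unique⇒length≤ (¬Any⇒All¬ vs x∉vs ∷ uniq))
  LSequence-length≤ minDeg {[]}    _           | yes _        = z≤n
  LSequence-length≤ minDeg {_ ∷ _} (_ , lcond) | yes covering =
    contradiction (λ x → inj₂ (covering x)) (LCond-∷⇒¬covering _ minDeg lcond)

module _ {n : ℕ} .{{_ : NonZero n}} where

  toℕ-mod : ∀ a → toℕ (a mod n) ≡ a % n
  toℕ-mod a = toℕ-fromℕ< (m%n<n a n)

  toℕ-mod-< : ∀ {a} → a < n → toℕ (a mod n) ≡ a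
  toℕ-mod-< {a} a<n = trans (toℕ-mod a) (m<n⇒m%n≡m a<n)

  suc[m%n]%n≡suc[m]%n : ∀ a → suc (a % n) % n ≡ suc a % n
  suc[m%n]%n≡suc[m]%n a = begin
    (1 + a % n) % n           ≡⟨ %-distribˡ-+ 1 (a % n) n ⟩
    (1 % n + a % n % n) % n   ≡⟨ cong (λ r → (1 % n + r) % n) (m%n%n≡m%n a n) ⟩
    (1 % n + a % n) % n       ≡⟨ %-distribˡ-+ 1 a n ⟨
    (1 + a) % n               ∎
    where open ≡-Reasoning

  [k+m]%n≢m : ∀ {k} m → 0 < k → k < n → (k + m) % n ≢ m
  [k+m]%n≢m {k} m 0<k k<n eq = not-a-multiple ((k + m) / n) (+-cancelˡ-≡ m k _ m+k≡m+q*n)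
    where
    m+k≡m+q*n : m + k ≡ m + (k + m) / n * n
    m+k≡m+q*n = begin
      m + k                          ≡⟨ +-comm m k ⟩
      k + m                          ≡⟨ m≡m%n+[m/n]*n (k + m) n ⟩
      (k + m) % n + (k + m) / n * n  ≡⟨ cong (_+ (k + m) / n * n) eq ⟩
      m + (k + m) / n * n            ∎
      where open ≡-Reasoning
    not-a-multiple : ∀ q → k ≢ q * n
    not-a-multiple zero    k≡0     = <⇒≱ 0<k (≤-reflexive k≡0)
    not-a-multiple (suc q) k≡n+q*n = <⇒≱ k<n (subst (n ≤_) (sym k≡n+q*n) (m≤m+n n (q * n)))

  cycleAdj-mod-suc : ∀ a → CycleAdj n (a mod n) (suc a mod n)
  cycleAdj-mod-suc a = inj₁ (begin
    toℕ (suc a mod n)          ≡⟨ toℕ-mod (suc a) ⟩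
    suc a % n                  ≡⟨ suc[m%n]%n≡suc[m]%n a ⟨
    suc (a % n) % n            ≡⟨ cong (λ r → suc r % n) (toℕ-mod a) ⟨
    suc (toℕ (a mod n)) % n    ∎)
    where open ≡-Reasoning

  cycleAdj-irrefl : 1 < n → ∀ u → ¬ CycleAdj n u u
  cycleAdj-irrefl 1<n u adj = [k+m]%n≢m (toℕ u) (s≤s z≤n) 1<n (sym (reduce adj))

  cycle-nonadjacent : ∀ {w u} → 2 + toℕ w ≤ toℕ u → 2 + toℕ u ≤ n → ¬ CycleAdj n w u
  cycle-nonadjacent {w} {u} w+1<u u+1<n (inj₁ u≡w+1) =
    <⇒≱ w+1<u (subst (_≤ suc (toℕ w)) (sym u≡w+1) (m%n≤m (suc (toℕ w)) n))
  cycle-nonadjacent {w} {u} w+1<u u+1<n (inj₂ w≡u+1) =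
    <⇒≱ (<⇒≤ w+1<u) (subst (toℕ u ≤_) (sym (trans w≡u+1 (m<n⇒m%n≡m u+1<n))) (n≤1+n (toℕ u)))

  -- The neighbours of u are u + 1 and u + (n − 1); they coincide only if (2 + u) % n ≡ u.
  cycle-MinDegree≥2 : 2 < n → MinDegree≥2 (Cycle n)
  cycle-MinDegree≥2 2<n u =
    next , prev , next≢prev , inj₂ (toℕ-mod (suc (toℕ u))) , inj₁ (sym suc[prev]%n≡u)
    where
    next prev : Fin n
    next = suc (toℕ u) mod n
    prev = (pred n + toℕ u) mod n
    open ≡-Reasoning
    suc[prev]%n≡u : suc (toℕ prev) % n ≡ toℕ u
    suc[prev]%n≡u = begin
      suc (toℕ prev) % n              ≡⟨ cong (λ r → suc r % n) (toℕ-mod (pred n + toℕ u)) ⟩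
      suc ((pred n + toℕ u) % n) % n  ≡⟨ suc[m%n]%n≡suc[m]%n (pred n + toℕ u) ⟩
      (suc (pred n) + toℕ u) % n      ≡⟨ cong (λ m → (m + toℕ u) % n) (suc-pred n) ⟩
      (n + toℕ u) % n                 ≡⟨ cong (_% n) (+-comm n (toℕ u)) ⟩
      (toℕ u + n) % n                 ≡⟨ [m+n]%n≡m%n (toℕ u) n ⟩
      toℕ u % n                       ≡⟨ m<n⇒m%n≡m (toℕ<n u) ⟩
      toℕ u                           ∎
    next≢prev : next ≢ prev
    next≢prev next≡prev = [k+m]%n≢m (toℕ u) (s≤s z≤n) 2<n (begin
      (2 + toℕ u) % n           ≡⟨ suc[m%n]%n≡suc[m]%n (suc (toℕ u)) ⟨
      suc (suc (toℕ u) % n) % n ≡⟨ cong (λ r → suc r % n) (toℕ-mod (suc (toℕ u))) ⟨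
      suc (toℕ next) % n        ≡⟨ cong (λ v → suc (toℕ v) % n) next≡prev ⟩
      suc (toℕ prev) % n        ≡⟨ suc[prev]%n≡u ⟩
      toℕ u                     ∎)

  -- skipSeq i j = i, i + 1, …, i + j − 1, i + j + 1, i + j + 2, omitting i + j.
  skipSeq : ℕ → ℕ → List (Fin n)
  skipSeq i zero    = suc i mod n ∷ suc (suc i) mod n ∷ []
  skipSeq i (suc j) = i mod n ∷ skipSeq (suc i) j

  skipSeq-length : ∀ i j → length (skipSeq i j) ≡ 2 + j
  skipSeq-length i zero    = refl
  skipSeq-length i (suc j) = cong suc (skipSeq-length (suc i) j)

  private
    shift : ∀ {i j} → 3 + i + suc j ≤ n → 3 + suc i + j ≤ n
    shift {i} {j} = subst (_≤ n) (cong (3 +_) (+-suc i j))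

    module FirstEntries (i j : ℕ) (bound : 3 + i + j ≤ n) where
      3+i≤n : 3 + i ≤ n
      3+i≤n = m+n≤o⇒m≤o (3 + i) bound

      toℕ-i : toℕ (i mod n) ≡ i
      toℕ-i = toℕ-mod-< (<⇒≤ (<⇒≤ 3+i≤n))

      toℕ-1+i : toℕ (suc i mod n) ≡ suc i
      toℕ-1+i = toℕ-mod-< (<⇒≤ 3+i≤n)

      toℕ-2+i : toℕ (suc (suc i) mod n) ≡ suc (suc i)
      toℕ-2+i = toℕ-mod-< 3+i≤n

  skipSeq-above : ∀ i j → 3 + i + j ≤ n → All (λ v → i ≤ toℕ v) (skipSeq i j)
  skipSeq-above i zero    bound =
    subst (i ≤_) (sym toℕ-1+i) (m≤n+m i 1) ∷ subst (i ≤_) (sym toℕ-2+i) (m≤n+m i 2) ∷ []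
    where open FirstEntries i 0 bound
  skipSeq-above i (suc j) bound =
    ≤-reflexive (sym toℕ-i) ∷ All.map (≤-trans (n≤1+n i)) (skipSeq-above (suc i) j (shift bound))
    where open FirstEntries i (suc j) bound

  skipSeq-unique : ∀ i j → 3 + i + j ≤ n → Unique (skipSeq i j)
  skipSeq-unique i zero    bound = (1+i≢2+i ∷ []) ∷ [] ∷ []
    where
    open FirstEntries i 0 bound
    1+i≢2+i : suc i mod n ≢ suc (suc i) mod n
    1+i≢2+i eq = 1+n≢n (trans (sym toℕ-2+i) (trans (cong toℕ (sym eq)) toℕ-1+i))
  skipSeq-unique i (suc j) bound =
    All.map i≢ (skipSeq-above (suc i) j (shift bound)) ∷ skipSeq-unique (suc i) j (shift bound)
    where
    open FirstEntries i (suc j) bound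
    i≢ : ∀ {v} → suc i ≤ toℕ v → i mod n ≢ v
    i≢ i<v refl = <⇒≱ i<v (≤-reflexive toℕ-i)

  nonadjacent-to-earlier : ∀ {i u prev} → toℕ u ≡ suc i → 3 + i ≤ n →
                           All (λ w → toℕ w < i) prev → All (λ w → ¬ CycleAdj n w u) prev
  nonadjacent-to-earlier {i} u≡1+i 3+i≤n = All.map λ {w} w<i →
    cycle-nonadjacent (subst (2 + toℕ w ≤_) (sym u≡1+i) (s≤s w<i))
                      (subst (λ t → 2 + t ≤ n) (sym u≡1+i) 3+i≤n)

  skipSeq-LCond : ∀ i j {prev} → 3 + i + j ≤ n → All (λ w → toℕ w < i) prev →
                  LCond (Cycle n) prev (skipSeq i j)
  skipSeq-LCond i zero    bound earlier =
    (suc i mod n , inj₁ refl , fresh) ,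
    (suc i mod n , inj₂ (swap (cycleAdj-mod-suc (suc i))) , cycleAdj-irrefl 1<n _ ∷ fresh) ,
    tt
    where
    open FirstEntries i 0 bound
    1<n : 1 < n
    1<n = ≤-trans (s≤s (s≤s z≤n)) 3+i≤n
    fresh : All (λ w → ¬ CycleAdj n w (suc i mod n)) _
    fresh = nonadjacent-to-earlier toℕ-1+i 3+i≤n earlier
  skipSeq-LCond i (suc j) bound earlier =
    (suc i mod n , inj₂ (cycleAdj-mod-suc i) , nonadjacent-to-earlier toℕ-1+i 3+i≤n earlier) ,
    skipSeq-LCond (suc i) j (shift bound) (≤-reflexive (cong suc toℕ-i) ∷ All.map m<n⇒m<1+n earlier)
    where open FirstEntries i (suc j) bound

lemma3p5 : (n : ℕ) → .{{_ : NonZero n}} → 3 ≤ n → IsLGrundyNumber (Cycle n) (n ∸ 1)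
lemma3p5 (suc (suc (suc m))) 3≤n@(s≤s (s≤s (s≤s _))) =
  (skipSeq 0 m , (skipSeq-unique 0 m ≤-refl , skipSeq-LCond 0 m ≤-refl []) , skipSeq-length 0 m) ,
  λ _ → LSequence-length≤ (cycle-MinDegree≥2 3≤n)
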